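{- Let $\mathcal H$ be the complete $3$-uniform hypergraph on a $12$-element vertex set $V$, with each edge (each $3$-subset of $V$) colored by one of three colors $c_1,c_2,c_3$, and suppose $\mathcal H$ contains no $4$ pairwise disjoint edges using at most two colors. Then for every partition $V=Y\cup Z$ with $Y\cap Z=\emptyset$ and $|Y|=|Z|=6$, at least one of $Y$, $Z$ is a $B$-set.
   Context: A set $S\subseteq V$ with $|S|=6$ is a $B$-set if there is one color that is not the color of any $3$-subset of $S$, and no two disjoint $3$-subsets of $S$ have the same color. -}

module Defs where

open import Data.Nat using (ℕ)
open import Data.Fin using (Fin)
open import Data.Fin.Subset using (Subset; _⊆_; _∩_; _∪_; ∣_∣; ⊥; ⊤)
open import Data.Product using (∃; _×_)
open import Data.Sum using (_⊎_)
open import Relation.Binary.PropositionalEquality using (_≡_; _≢_)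
open import Relation.Nullary using (¬_)
import Data.Empty as E

V : Set
V = Fin 12

Edge : Subset 12 → Set
Edge e = ∣ e ∣ ≡ 3

-- A 3-coloring of the edges of the complete 3-uniform hypergraph on V.
-- It is given on all subsets; only its values on 3-subsets are ever used.
Coloring : Set
Coloring = Subset 12 → Fin 3

Disjoint : {n : ℕ} → Subset n → Subset n → Set
Disjoint x y = x ∩ y ≡ ⊥

NoFourDisjointTwoColored : Coloring → Set
NoFourDisjointTwoColored χ =
  (E : Fin 4 → Subset 12) → (∀ i → Edge (E i)) →
  (∀ i j → i ≢ j → Disjoint (E i) (E j)) →
  (a b : Fin 3) → (∀ i → χ (E i) ≡ a ⊎ χ (E i) ≡ b) → E.⊥

IsBSet : Coloring → Subset 12 → Set
IsBSet χ S =
  ∣ S ∣ ≡ 6 ×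
  ∃ (λ (c : Fin 3) → ∀ T → T ⊆ S → Edge T → χ T ≢ c) ×
  (∀ T T′ → T ⊆ S → T′ ⊆ S → Edge T → Edge T′ → Disjoint T T′ → χ T ≢ χ T′)

-- Call two disjoint
-- 3-subsets of a set S an "edge pair in S".  The proof rests on one
-- observation: an edge pair in Y and an edge pair in Z are four pairwise
-- disjoint edges, so by hypothesis they must use at least three colors.
--
--  * If Y contains a same-colored edge pair (colour c), then in Z no edge has
--    colour c (it would form an edge pair with its complement in Z) and no
--    edge pair is same-colored; so Z is a B-set.  Symmetrically for Z.
--  * Otherwise, if some colour occurs on no edge of Y (or of Z), that set is
--    a B-set.
--  * In the remaining case every colour c occurs on an edge T ⊆ Y whose
--    complement Y ─ T has colour y(c) ≠ c, and likewise z(c) ≠ c for Z.  A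
--    small lemma about fixed-point-free maps on Fin 3 (sharedPair) yields
--    colours i, j with {i, y i} and {j, z j} inside one 2-set of colours,
--    i.e. four disjoint edges with two colours: a contradiction.
module Submission where

open import Defs
open import Data.Bool using () renaming (_≟_ to _≟ᵇ_)
open import Data.Empty using (⊥-elim)
import Data.Empty as Empty
open import Data.Fin using (Fin; zero; suc; _≟_)
open import Data.Fin.Properties using (all?; ¬∀⟶∃¬)
open import Data.Fin.Subset using (Subset; _∩_; _∪_; ∣_∣; ⊥; ⊤; _⊆_; _─_; _∈_; inside; outside)
open import Data.Fin.Subset.Properties using (anySubset?; _⊆?_; Empty-unique; x∈p∩q⁻; x∈p∩q⁺; ∉⊥; p─q⊆p; ∩-comm; drop-∷-⊆)
open import Data.Nat using (ℕ; suc; _+_) renaming (_≟_ to _≟ℕ_)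
open import Data.Nat.Properties using (+-suc; +-cancelˡ-≡)
open import Data.Product using (Σ; ∃; _×_; _,_; proj₂)
open import Data.Sum using (_⊎_; inj₁; inj₂) renaming (map to ⊎-map)
open import Data.Vec using (_∷_; []; here)
open import Data.Vec.Properties using (≡-dec)
open import Relation.Nullary using (¬_; Dec; yes; no; ¬?)
open import Relation.Nullary.Decidable using (_×-dec_; _→-dec_; from-yes; map′)
open import Relation.Binary.PropositionalEquality using (_≡_; _≢_; refl; sym; trans; cong; subst)

private
  variable
    n : ℕ

∣T∣+∣S─T∣≡∣S∣ : (S T : Subset n) → T ⊆ S → ∣ T ∣ + ∣ S ─ T ∣ ≡ ∣ S ∣
∣T∣+∣S─T∣≡∣S∣ []            []            _   = refl
∣T∣+∣S─T∣≡∣S∣ (inside  ∷ S) (inside  ∷ T) T⊆S = cong suc (∣T∣+∣S─T∣≡∣S∣ S T (drop-∷-⊆ T⊆S))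
∣T∣+∣S─T∣≡∣S∣ (inside  ∷ S) (outside ∷ T) T⊆S =
  trans (+-suc ∣ T ∣ ∣ S ─ T ∣) (cong suc (∣T∣+∣S─T∣≡∣S∣ S T (drop-∷-⊆ T⊆S)))
∣T∣+∣S─T∣≡∣S∣ (outside ∷ S) (outside ∷ T) T⊆S = ∣T∣+∣S─T∣≡∣S∣ S T (drop-∷-⊆ T⊆S)
∣T∣+∣S─T∣≡∣S∣ (outside ∷ S) (inside  ∷ T) T⊆S with T⊆S here
... | ()

disjoint-─ : (S T : Subset n) → Disjoint T (S ─ T)
disjoint-─ []            []            = refl
disjoint-─ (_       ∷ S) (outside ∷ T) = cong (outside ∷_) (disjoint-─ S T)
disjoint-─ (inside  ∷ S) (inside  ∷ T) = cong (outside ∷_) (disjoint-─ S T)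
disjoint-─ (outside ∷ S) (inside  ∷ T) = cong (outside ∷_) (disjoint-─ S T)

disjoint-sym : (A B : Subset n) → Disjoint A B → Disjoint B A
disjoint-sym A B A∩B≡⊥ = trans (∩-comm B A) A∩B≡⊥

disjoint-⊆ : (Y Z T U : Subset n) → Disjoint Y Z → T ⊆ Y → U ⊆ Z → Disjoint T U
disjoint-⊆ Y Z T U Y∩Z≡⊥ T⊆Y U⊆Z = Empty-unique λ (x , x∈T∩U) →
  let (x∈T , x∈U) = x∈p∩q⁻ T U x∈T∩U
  in ∉⊥ (subst (x ∈_) Y∩Z≡⊥ (x∈p∩q⁺ (T⊆Y x∈T , U⊆Z x∈U)))

record EdgePair (S : Subset 12) : Set where
  constructor edgePair
  field
    first second       : Subset 12
    first⊆S            : first ⊆ S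
    second⊆S           : second ⊆ S
    firstEdge          : Edge first
    secondEdge         : Edge second
    firstDisjointSecond : Disjoint first second

open EdgePair

complementPair : (S T : Subset 12) → ∣ S ∣ ≡ 6 → T ⊆ S → Edge T → EdgePair S
complementPair S T ∣S∣≡6 T⊆S ∣T∣≡3 =
  edgePair T (S ─ T) T⊆S (p─q⊆p S T) ∣T∣≡3 ∣S─T∣≡3 (disjoint-─ S T)
  where
  ∣S─T∣≡3 : ∣ S ─ T ∣ ≡ 3
  ∣S─T∣≡3 = +-cancelˡ-≡ 3 _ _ (trans (subst (λ k → k + ∣ S ─ T ∣ ≡ ∣ S ∣) ∣T∣≡3
                                              (∣T∣+∣S─T∣≡∣S∣ S T T⊆S)) ∣S∣≡6)

Within : Fin 3 → Fin 3 → Fin 3 → Set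
Within a b x = x ≡ a ⊎ x ≡ b

ColoredWithin : Coloring → Fin 3 → Fin 3 → {S : Subset 12} → EdgePair S → Set
ColoredWithin χ a b P = Within a b (χ (first P)) × Within a b (χ (second P))

noTwoColoredPairs : (χ : Coloring) → NoFourDisjointTwoColored χ →
  (Y Z : Subset 12) → Disjoint Y Z → (P : EdgePair Y) (Q : EdgePair Z) →
  (a b : Fin 3) → ColoredWithin χ a b P → ColoredWithin χ a b Q → Empty.⊥
noTwoColoredPairs χ noFour Y Z Y∩Z≡⊥ P Q a b (P₁ , P₂) (Q₁ , Q₂) =
  noFour E isEdge pairwiseDisjoint a b colored
  where
  E : Fin 4 → Subset 12
  E zero                   = first P
  E (suc zero)             = second P
  E (suc (suc zero))       = first Q
  E (suc (suc (suc zero))) = second Q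

  isEdge : ∀ i → Edge (E i)
  isEdge zero                   = firstEdge P
  isEdge (suc zero)             = secondEdge P
  isEdge (suc (suc zero))       = firstEdge Q
  isEdge (suc (suc (suc zero))) = secondEdge Q

  colored : ∀ i → Within a b (χ (E i))
  colored zero                   = P₁
  colored (suc zero)             = P₂
  colored (suc (suc zero))       = Q₁
  colored (suc (suc (suc zero))) = Q₂

  across : ∀ {T U} → T ⊆ Y → U ⊆ Z → Disjoint T U
  across = disjoint-⊆ Y Z _ _ Y∩Z≡⊥

  across′ : ∀ {T U} → T ⊆ Y → U ⊆ Z → Disjoint U T
  across′ T⊆Y U⊆Z = disjoint-sym _ _ (across T⊆Y U⊆Z)

  pairwiseDisjoint : ∀ i j → i ≢ j → Disjoint (E i) (E j)
  pairwiseDisjoint zero                   zero                   i≢j = ⊥-elim (i≢j refl)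
  pairwiseDisjoint zero                   (suc zero)             _   = firstDisjointSecond P
  pairwiseDisjoint zero                   (suc (suc zero))       _   = across (first⊆S P) (first⊆S Q)
  pairwiseDisjoint zero                   (suc (suc (suc zero))) _   = across (first⊆S P) (second⊆S Q)
  pairwiseDisjoint (suc zero)             zero                   _   = disjoint-sym _ _ (firstDisjointSecond P)
  pairwiseDisjoint (suc zero)             (suc zero)             i≢j = ⊥-elim (i≢j refl)
  pairwiseDisjoint (suc zero)             (suc (suc zero))       _   = across (second⊆S P) (first⊆S Q)
  pairwiseDisjoint (suc zero)             (suc (suc (suc zero))) _   = across (second⊆S P) (second⊆S Q)
  pairwiseDisjoint (suc (suc zero))       zero                   _   = across′ (first⊆S P) (first⊆S Q)
  pairwiseDisjoint (suc (suc zero))       (suc zero)             _   = across′ (second⊆S P) (first⊆S Q)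
  pairwiseDisjoint (suc (suc zero))       (suc (suc zero))       i≢j = ⊥-elim (i≢j refl)
  pairwiseDisjoint (suc (suc zero))       (suc (suc (suc zero))) _   = firstDisjointSecond Q
  pairwiseDisjoint (suc (suc (suc zero))) zero                   _   = across′ (first⊆S P) (second⊆S Q)
  pairwiseDisjoint (suc (suc (suc zero))) (suc zero)             _   = across′ (second⊆S P) (second⊆S Q)
  pairwiseDisjoint (suc (suc (suc zero))) (suc (suc zero))       _   = disjoint-sym _ _ (firstDisjointSecond Q)
  pairwiseDisjoint (suc (suc (suc zero))) (suc (suc (suc zero))) i≢j = ⊥-elim (i≢j refl)

SameColoredPair : Coloring → Subset 12 → Set
SameColoredPair χ S = Σ (EdgePair S) λ P → χ (first P) ≡ χ (second P)

sameColoredPair? : (χ : Coloring) (S : Subset 12) → Dec (SameColoredPair χ S)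
sameColoredPair? χ S = map′ toPair fromPair
  (anySubset? λ T → anySubset? λ T′ → (T ⊆? S) ×-dec (T′ ⊆? S) ×-dec
    (∣ T ∣ ≟ℕ 3) ×-dec (∣ T′ ∣ ≟ℕ 3) ×-dec ≡-dec _≟ᵇ_ (T ∩ T′) ⊥ ×-dec (χ T ≟ χ T′))
  where
  Unpacked : Set
  Unpacked = ∃ λ T → ∃ λ T′ →
    T ⊆ S × T′ ⊆ S × Edge T × Edge T′ × Disjoint T T′ × χ T ≡ χ T′
  toPair : Unpacked → SameColoredPair χ S
  toPair (T , T′ , s , s′ , e , e′ , d , eq) = edgePair T T′ s s′ e e′ d , eq
  fromPair : SameColoredPair χ S → Unpacked
  fromPair (edgePair T T′ s s′ e e′ d , eq) = T , T′ , s , s′ , e , e′ , d , eq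

ColorOccurs : Coloring → Subset 12 → Fin 3 → Set
ColorOccurs χ S c = ∃ λ T → T ⊆ S × Edge T × χ T ≡ c

colorOccurs? : (χ : Coloring) (S : Subset 12) (c : Fin 3) → Dec (ColorOccurs χ S c)
colorOccurs? χ S c = anySubset? λ T → (T ⊆? S) ×-dec (∣ T ∣ ≟ℕ 3) ×-dec (χ T ≟ c)

isBSet : (χ : Coloring) (S : Subset 12) (c : Fin 3) → ∣ S ∣ ≡ 6 →
  ¬ ColorOccurs χ S c → ¬ SameColoredPair χ S → IsBSet χ S
isBSet χ S c ∣S∣≡6 c∉S noPair =
  ∣S∣≡6 , (c , λ T T⊆S e χT≡c → c∉S (T , T⊆S , e , χT≡c)) ,
  λ T T′ s s′ e e′ d eq → noPair (edgePair T T′ s s′ e e′ d , eq)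

partnerIsBSet : (χ : Coloring) → NoFourDisjointTwoColored χ → (Y Z : Subset 12) →
  Disjoint Y Z → ∣ Z ∣ ≡ 6 → SameColoredPair χ Y → IsBSet χ Z
partnerIsBSet χ noFour Y Z Y∩Z≡⊥ ∣Z∣≡6 (P , samePair) =
  isBSet χ Z (χ (first P)) ∣Z∣≡6 colorMissing noSamePair
  where
  P-within : ∀ b → ColoredWithin χ (χ (first P)) b P
  P-within b = inj₁ refl , inj₁ (sym samePair)

  colorMissing : ¬ ColorOccurs χ Z (χ (first P))
  colorMissing (U , U⊆Z , e , χU≡c) =
    noTwoColoredPairs χ noFour Y Z Y∩Z≡⊥ P (complementPair Z U ∣Z∣≡6 U⊆Z e) _ _
      (P-within _) (inj₁ χU≡c , inj₂ refl)

  noSamePair : ¬ SameColoredPair χ Z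
  noSamePair (Q , sameQ) =
    noTwoColoredPairs χ noFour Y Z Y∩Z≡⊥ P Q _ _
      (P-within _) (inj₂ refl , inj₂ (sym sameQ))

outsidePairUnique : (a b x y : Fin 3) → a ≢ b → x ≢ a → x ≢ b → y ≢ a → y ≢ b → x ≡ y
outsidePairUnique = from-yes (all? {3} λ a → all? {3} λ b → all? {3} λ x → all? {3} λ y →
  ¬? (a ≟ b) →-dec ¬? (x ≟ a) →-dec ¬? (x ≟ b) →-dec ¬? (y ≟ a) →-dec ¬? (y ≟ b) →-dec (x ≟ y))

SharedPair : (Fin 3 → Fin 3) → (Fin 3 → Fin 3) → Set
SharedPair y z = ∃ λ i → ∃ λ j → ∃ λ a → ∃ λ b →
  Within a b i × Within a b (y i) × Within a b j × Within a b (z j)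

sharedPair : (y z : Fin 3 → Fin 3) → (∀ i → y i ≢ i) → (∀ j → z j ≢ j) → SharedPair y z
sharedPair y z y-free z-free with z zero ≟ y zero
... | yes z0≡y0 = zero , zero , zero , y zero , inj₁ refl , inj₂ refl , inj₁ refl , inj₂ z0≡y0
... | no  z0≢y0 with z (y zero) ≟ zero
...   | yes zy0≡0 = zero , y zero , zero , y zero , inj₁ refl , inj₂ refl , inj₂ refl , inj₁ zy0≡0
...   | no  zy0≢0 with y (z zero) ≟ zero
...     | yes yc≡0 = z zero , zero , zero , z zero , inj₂ refl , inj₁ yc≡0 , inj₁ refl , inj₂ refl
...     | no  yc≢0 = z zero , y zero , y zero , z zero , inj₂ refl , inj₁ yc≡y0 , inj₁ refl , inj₂ zy0≡c
  where
  -- With c = z 0, the colours 0, y 0, c are pairwise distinct, so z (y 0)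
  -- (avoiding 0 and y 0) must be c, and y c (avoiding 0 and c) must be y 0.
  0≢y0 : zero ≢ y zero
  0≢y0 eq = y-free zero (sym eq)
  zy0≡c : z (y zero) ≡ z zero
  zy0≡c = outsidePairUnique zero (y zero) _ _ 0≢y0 zy0≢0 (z-free (y zero)) (z-free zero) z0≢y0
  yc≡y0 : y (z zero) ≡ y zero
  yc≡y0 = outsidePairUnique zero (z zero) _ _ (λ eq → z-free zero (sym eq))
    yc≢0 (y-free (z zero)) (y-free zero) (λ eq → z0≢y0 (sym eq))

complementColors : (χ : Coloring) (S : Subset 12) → ∣ S ∣ ≡ 6 →
  (∀ c → ColorOccurs χ S c) → ¬ SameColoredPair χ S →
  Σ (Fin 3 → EdgePair S) λ P → (∀ c → χ (first (P c)) ≡ c) × (∀ c → χ (second (P c)) ≢ c)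
complementColors χ S ∣S∣≡6 occurs noPair = P , firstColor , secondColor
  where
  P : Fin 3 → EdgePair S
  P c = let (T , T⊆S , e , _) = occurs c in complementPair S T ∣S∣≡6 T⊆S e
  firstColor : ∀ c → χ (first (P c)) ≡ c
  firstColor c = proj₂ (proj₂ (proj₂ (occurs c)))
  secondColor : ∀ c → χ (second (P c)) ≢ c
  secondColor c eq = noPair (P c , trans (firstColor c) (sym eq))

notAllColorsInBoth : (χ : Coloring) → NoFourDisjointTwoColored χ → (Y Z : Subset 12) →
  Disjoint Y Z → ∣ Y ∣ ≡ 6 → ∣ Z ∣ ≡ 6 → ¬ SameColoredPair χ Y → ¬ SameColoredPair χ Z →
  (∀ c → ColorOccurs χ Y c) → (∀ c → ColorOccurs χ Z c) → Empty.⊥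
notAllColorsInBoth χ noFour Y Z Y∩Z≡⊥ ∣Y∣≡6 ∣Z∣≡6 noPairY noPairZ occursY occursZ
  with complementColors χ Y ∣Y∣≡6 occursY noPairY | complementColors χ Z ∣Z∣≡6 occursZ noPairZ
... | P , P-first , P-second | Q , Q-first , Q-second
  with sharedPair (λ c → χ (second (P c))) (λ c → χ (second (Q c))) P-second Q-second
...   | i , j , a , b , i∈ab , yi∈ab , j∈ab , zj∈ab =
  noTwoColoredPairs χ noFour Y Z Y∩Z≡⊥ (P i) (Q j) a b
    (⊎-map (trans (P-first i)) (trans (P-first i)) i∈ab , yi∈ab)
    (⊎-map (trans (Q-first j)) (trans (Q-first j)) j∈ab , zj∈ab)

bSetWithoutPairs : (χ : Coloring) → NoFourDisjointTwoColored χ → (Y Z : Subset 12) →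
  Disjoint Y Z → ∣ Y ∣ ≡ 6 → ∣ Z ∣ ≡ 6 → ¬ SameColoredPair χ Y → ¬ SameColoredPair χ Z →
  Dec (∀ c → ColorOccurs χ Y c) → Dec (∀ c → ColorOccurs χ Z c) → IsBSet χ Y ⊎ IsBSet χ Z
bSetWithoutPairs χ noFour Y Z Y∩Z≡⊥ ∣Y∣≡6 ∣Z∣≡6 noPairY noPairZ (no notAllY) _ =
  let (c , c∉Y) = ¬∀⟶∃¬ 3 (ColorOccurs χ Y) (colorOccurs? χ Y) notAllY
  in inj₁ (isBSet χ Y c ∣Y∣≡6 c∉Y noPairY)
bSetWithoutPairs χ noFour Y Z Y∩Z≡⊥ ∣Y∣≡6 ∣Z∣≡6 noPairY noPairZ (yes _) (no notAllZ) =
  let (c , c∉Z) = ¬∀⟶∃¬ 3 (ColorOccurs χ Z) (colorOccurs? χ Z) notAllZ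
  in inj₂ (isBSet χ Z c ∣Z∣≡6 c∉Z noPairZ)
bSetWithoutPairs χ noFour Y Z Y∩Z≡⊥ ∣Y∣≡6 ∣Z∣≡6 noPairY noPairZ (yes allY) (yes allZ) =
  ⊥-elim (notAllColorsInBoth χ noFour Y Z Y∩Z≡⊥ ∣Y∣≡6 ∣Z∣≡6 noPairY noPairZ allY allZ)

mainTheorem6 : (χ : Coloring) → NoFourDisjointTwoColored χ →
    (Y Z : Subset 12) → Y ∪ Z ≡ ⊤ → Y ∩ Z ≡ ⊥ → ∣ Y ∣ ≡ 6 → ∣ Z ∣ ≡ 6 →
    IsBSet χ Y ⊎ IsBSet χ Z
mainTheorem6 χ noFour Y Z _ Y∩Z≡⊥ ∣Y∣≡6 ∣Z∣≡6 =
  byPairs (sameColoredPair? χ Y) (sameColoredPair? χ Z)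
  where
  byPairs : Dec (SameColoredPair χ Y) → Dec (SameColoredPair χ Z) → IsBSet χ Y ⊎ IsBSet χ Z
  byPairs (yes pairY) _ = inj₂ (partnerIsBSet χ noFour Y Z Y∩Z≡⊥ ∣Z∣≡6 pairY)
  byPairs (no _) (yes pairZ) =
    inj₁ (partnerIsBSet χ noFour Z Y (disjoint-sym Y Z Y∩Z≡⊥) ∣Y∣≡6 pairZ)
  byPairs (no noPairY) (no noPairZ) =
    bSetWithoutPairs χ noFour Y Z Y∩Z≡⊥ ∣Y∣≡6 ∣Z∣≡6 noPairY noPairZ
      (all? (colorOccurs? χ Y)) (all? (colorOccurs? χ Z))
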